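{- Let $G=(V,E)$ be a finite simple $k$-regular $k$-connected graph with $k\geq 3$ and $|V|\geq 2(k-h)+3$. Then for every integer $h$ with $0\leq h\leq \lfloor (k-1)/2\rfloor$, the $h$-edge tolerable diagnosability of $G$ under the MM$^*$ model is $t_h^e(G)=k-h$.
   Context: A graph is $k$-connected if its vertex connectivity is at least $k$, and $k$-regular if every vertex has exactly $k$ neighbors. For sets $A,B$, $A-B$ is set difference and $F_1\bigtriangleup F_2=(F_1-F_2)\cup(F_2-F_1)$. Under the MM$^*$ model, a graph $G=(V,E)$ is $t$-diagnosable if and only if for any two distinct subsets $F_1,F_2\subseteq V$ with $|F_1|\leq t$, $|F_2|\leq t$, at least one of the following holds: (1) there are $u,w\in V-(F_1\cup F_2)$ and $v\in F_1\bigtriangleup F_2$ with $uv,uw\in E$; (2) there are $u,v\in F_1-F_2$ and $w\in V-(F_1\cup F_2)$ with $uw,vw\in E$; (3) there are $u,v\in F_2-F_1$ and $w\in V-(F_1\cup F_2)$ with $uw,vw\in E$. A graph $G$ is $h$-edge tolerable $t$-diagnosable under the model if for every $F_e\subseteq E$ with $|F_e|\leq h$, $G-F_e$ is $t$-diagnosable under the model; $t_h^e(G)$ is the maximum such $t$. -}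

module Defs where

open import Data.Nat using (ℕ; _≤_; _<_)
open import Data.Bool using (Bool; true; false; T)
open import Data.Fin using (Fin)
open import Data.Fin.Subset using (Subset; _∈_; _∉_; ∣_∣)
open import Data.Vec using (tabulate)
open import Data.List using (List; length)
open import Data.List.Membership.Propositional using () renaming (_∈_ to _∈ₗ_)
open import Data.Product using (Σ; _×_; _,_; ∃-syntax)
open import Data.Sum using (_⊎_)
open import Relation.Nullary using (¬_)
open import Relation.Binary.PropositionalEquality using (_≡_; _≢_)

record SimpleGraph (n : ℕ) : Set where
  field
    adj       : Fin n → Fin n → Bool
    adj-sym   : ∀ u v → adj u v ≡ adj v u
    adj-irref : ∀ v → adj v v ≡ false
open SimpleGraph public

Edge : ∀ {n} → SimpleGraph n → Fin n → Fin n → Set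
Edge G u v = T (adj G u v)

nbhd : ∀ {n} → SimpleGraph n → Fin n → Subset n
nbhd G v = tabulate (λ u → adj G v u)

Regular : ∀ {n} → SimpleGraph n → ℕ → Set
Regular G k = ∀ v → ∣ nbhd G v ∣ ≡ k

data WalkAvoiding {n} (G : SimpleGraph n) (S : Subset n) : Fin n → Fin n → Set where
  here : ∀ {u} → u ∉ S → WalkAvoiding G S u u
  step : ∀ {u w v} → u ∉ S → Edge G u w → WalkAvoiding G S w v → WalkAvoiding G S u v

Connected : ∀ {n} → SimpleGraph n → ℕ → Set
Connected {n} G k =
  k < n × (∀ (S : Subset n) → ∣ S ∣ < k → ∀ u v → u ∉ S → v ∉ S → WalkAvoiding G S u v)

-- t-diagnosability under the MM* model (Sengupta–Dahbura characterization),
-- for an arbitrary (Set-valued) adjacency relation on Fin n.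
Diagnosable : (n : ℕ) → (Fin n → Fin n → Set) → ℕ → Set
Diagnosable n E t =
  ∀ (F₁ F₂ : Subset n) → F₁ ≢ F₂ → ∣ F₁ ∣ ≤ t → ∣ F₂ ∣ ≤ t →
    (∃[ u ] ∃[ w ] ∃[ v ]
       (u ∉ F₁ × u ∉ F₂) × (w ∉ F₁ × w ∉ F₂) ×
       ((v ∈ F₁ × v ∉ F₂) ⊎ (v ∈ F₂ × v ∉ F₁)) ×
       E u v × E u w)
  ⊎
    (∃[ u ] ∃[ v ] ∃[ w ]
       u ≢ v × (u ∈ F₁ × u ∉ F₂) × (v ∈ F₁ × v ∉ F₂) × (w ∉ F₁ × w ∉ F₂) ×
       E u w × E v w)
  ⊎
    (∃[ u ] ∃[ v ] ∃[ w ]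
       u ≢ v × (u ∈ F₂ × u ∉ F₁) × (v ∈ F₂ × v ∉ F₁) × (w ∉ F₁ × w ∉ F₂) ×
       E u w × E v w)

EdgeDeleted : ∀ {n} → SimpleGraph n → List (Fin n × Fin n) → Fin n → Fin n → Set
EdgeDeleted G Fe u v = Edge G u v × ¬ ((u , v) ∈ₗ Fe) × ¬ ((v , u) ∈ₗ Fe)

EdgeTolerableDiagnosable : ∀ {n} → SimpleGraph n → ℕ → ℕ → Set
EdgeTolerableDiagnosable {n} G h t =
  ∀ (Fe : List (Fin n × Fin n)) → length Fe ≤ h → Diagnosable n (EdgeDeleted G Fe) t

EdgeTolerableDiagnosability≡ : ∀ {n} → SimpleGraph n → ℕ → ℕ → Set
EdgeTolerableDiagnosability≡ G h m =
  EdgeTolerableDiagnosable G h m × (∀ t → EdgeTolerableDiagnosable G h t → t ≤ m)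

module Submission where

-- Lower bound (t = k - h).  Let Fe delete ≤ h edges and let F₁ ≠ F₂, of size
-- ≤ t, violate all three Sengupta–Dahbura alternatives in G - Fe.  Split the
-- vertices into S = F₁ ∩ F₂, `near` (F₁ △ F₂ and the healthy vertices
-- adjacent to it) and `far` (the other healthy ones); no edge of G - Fe joins
-- near and far.  If far is nonempty, k-connectivity (S plus a cover of the
-- deleted edges has < k vertices) makes every near–far pair a deleted edge,
-- so |near|·|far| ≤ h and n ≤ k.  If far is empty, counting the k edges at
-- each healthy vertex in two ways contradicts n ≥ 2t + 3.
-- Upper bound.  Deleting h edges at a vertex v makes N(v) and N(v) ∪ {v}
-- indistinguishable, so no t > k - h works.

open import Defs
open import Data.Nat using (ℕ; zero; suc; _≤_; _<_; _+_; _*_; _∸_; _⊓_; ⌊_/2⌋; ⌈_/2⌉; z≤n; s≤s; _≤?_)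
open import Data.Nat.Properties
open import Data.Bool using (Bool; true; false; T; _∧_; _∨_; not)
open import Data.Bool.Properties using (not-involutive; ∧-comm; ∨-comm; ∧-identityʳ; ∧-zeroʳ; T-∧; T-∨)
open import Data.Fin using (Fin; zero; suc; fromℕ<)
import Data.Fin.Properties as Finₚ
open import Data.Fin.Subset using (Subset; _∈_; _∉_; ∣_∣)
open import Data.Fin.Subset.Properties using (_∈?_)
open import Data.Vec using ([]; _∷_; lookup; tabulate)
open import Data.Vec.Properties using ([]=⇒lookup; lookup⇒[]=; lookup∘tabulate; tabulate∘lookup; tabulate-cong)
open import Data.List using (List; []; _∷_; length; map; take; drop; filter; filterᵇ; allFin)
  renaming (tabulate to tabulateₗ)
open import Data.List.Properties using (length-filter; length-map; length-take; length-drop; take++drop≡id)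
open import Data.List.Membership.Propositional.Properties using (∈-filter⁺; ∈-filter⁻; ∈-allFin; ∈-map⁺; ∈-++⁻)
open import Data.List.Relation.Unary.Any using (here; there)
open import Data.List.Membership.Propositional using (find; lose) renaming (_∈_ to _∈ₗ_)
import Data.List.Relation.Unary.Any as Any
open import Data.Product.Properties using (≡-dec)
open import Data.Empty using (⊥; ⊥-elim)
open import Data.Unit using (tt)
open import Data.Product using (_×_; _,_; proj₁; proj₂; ∃-syntax)
open import Data.Sum using (_⊎_; inj₁; inj₂; swap; [_,_]′)
open import Function using (id; _∘_; Equivalence)
open import Relation.Nullary using (¬_; Dec; yes; no)
open import Relation.Nullary.Decidable using (map′; isYes; toWitness; fromWitness; T?; ¬?; _×-dec_; _⊎-dec_; decidable-stable)
open import Relation.Unary using (Decidable)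
open import Relation.Binary.PropositionalEquality
  using (_≡_; _≢_; refl; sym; trans; cong; cong₂; subst; module ≡-Reasoning)
open import Data.Nat.Tactic.RingSolver using (solve-∀)
open import Algebra.Properties.Semiring.Sum +-*-semiring
  using (sum; sum-syntax; ∑-distrib-+; ∑-comm; sum-cong-≗; *-distribˡ-sum; *-distribʳ-sum)

T-∧⁻ : ∀ {a b} → T (a ∧ b) → T a × T b
T-∧⁻ = Equivalence.to T-∧

T-∧⁺ : ∀ {a b} → T a → T b → T (a ∧ b)
T-∧⁺ Ta Tb = Equivalence.from T-∧ (Ta , Tb)

T-∨⁻ : ∀ {a b} → T (a ∨ b) → T a ⊎ T b
T-∨⁻ = Equivalence.to T-∨

T-∨ˡ : ∀ {a b} → T a → T (a ∨ b)
T-∨ˡ Ta = Equivalence.from T-∨ (inj₁ Ta)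

T-∨ʳ : ∀ {a b} → T b → T (a ∨ b)
T-∨ʳ Tb = Equivalence.from T-∨ (inj₂ Tb)

T-not⁺ : ∀ {a} → ¬ T a → T (not a)
T-not⁺ {true} ¬Ta = ¬Ta tt
T-not⁺ {false} _ = tt

T-not⁻ : ∀ {a} → T (not a) → ¬ T a
T-not⁻ {true} ()

⟦_⟧ : Bool → ℕ
⟦ true ⟧ = 1
⟦ false ⟧ = 0

count : ∀ {n} → (Fin n → Bool) → ℕ
count {n} P = ∑[ i < n ] ⟦ P i ⟧

sum-mono : ∀ {n} {f g : Fin n → ℕ} → (∀ i → f i ≤ g i) → sum f ≤ sum g
sum-mono {zero} _ = z≤n
sum-mono {suc n} f≤g = +-mono-≤ (f≤g zero) (sum-mono (f≤g ∘ suc))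

sum-ones : ∀ {n} {f : Fin n → ℕ} → (∀ i → f i ≡ 1) → sum f ≡ n
sum-ones {zero} _ = refl
sum-ones {suc n} f≡1 = cong₂ _+_ (f≡1 zero) (sum-ones (f≡1 ∘ suc))

term≤sum : ∀ {n} (f : Fin n → ℕ) i → f i ≤ sum f
term≤sum f zero = m≤m+n _ _
term≤sum f (suc i) = ≤-trans (term≤sum (f ∘ suc) i) (m≤n+m _ _)

⟦⟧-true : ∀ {b} → T b → ⟦ b ⟧ ≡ 1
⟦⟧-true {true} _ = refl

count-cong : ∀ {n} {P Q : Fin n → Bool} → (∀ i → P i ≡ Q i) → count P ≡ count Q
count-cong P≡Q = sum-cong-≗ (cong ⟦_⟧ ∘ P≡Q)

count-mono : ∀ {n} {P Q : Fin n → Bool} → (∀ i → T (P i) → T (Q i)) → count P ≤ count Q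
count-mono {P = P} {Q} P⊆Q = sum-mono (λ i → ⟦⟧-mono (P i) (Q i) (P⊆Q i))
  where
  ⟦⟧-mono : ∀ a b → (T a → T b) → ⟦ a ⟧ ≤ ⟦ b ⟧
  ⟦⟧-mono true true _ = ≤-refl
  ⟦⟧-mono true false a⇒b = ⊥-elim (a⇒b tt)
  ⟦⟧-mono false b _ = z≤n

count-pos : ∀ {n} (P : Fin n → Bool) i → T (P i) → 1 ≤ count P
count-pos P i Pi with P i | term≤sum (λ j → ⟦ P j ⟧) i
... | true | Pi≤count = Pi≤count

count-none : ∀ {n} (P : Fin n → Bool) → (∀ i → ¬ T (P i)) → count P ≡ 0
count-none {zero} P _ = refl
count-none {suc n} P none with P zero | none zero
... | true | ¬P0 = ⊥-elim (¬P0 tt)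
... | false | _ = count-none (P ∘ suc) (none ∘ suc)

count-unique : ∀ {n} (P : Fin n → Bool) → (∀ i j → T (P i) → T (P j) → i ≡ j) → count P ≤ 1
count-unique {zero} P _ = z≤n
count-unique {suc n} P unique with P zero in P0
... | true = ≤-reflexive (cong suc (count-none (P ∘ suc) (λ i Pi → Finₚ.0≢1+n (unique zero (suc i) (subst T (sym P0) tt) Pi))))
... | false = count-unique (P ∘ suc) (λ i j Pi Pj → Finₚ.suc-injective (unique (suc i) (suc j) Pi Pj))

count-∨ : ∀ {n} (P Q : Fin n → Bool) → count (λ i → P i ∨ Q i) ≤ count P + count Q
count-∨ P Q = ≤-trans (sum-mono (λ i → ⟦∨⟧ (P i) (Q i))) (≤-reflexive (∑-distrib-+ (⟦_⟧ ∘ P) (⟦_⟧ ∘ Q)))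
  where
  ⟦∨⟧ : ∀ a b → ⟦ a ∨ b ⟧ ≤ ⟦ a ⟧ + ⟦ b ⟧
  ⟦∨⟧ true b = s≤s z≤n
  ⟦∨⟧ false b = ≤-refl

count-∨-∧ : ∀ {n} (P Q : Fin n → Bool) →
            count (λ i → P i ∨ Q i) + count (λ i → P i ∧ Q i) ≡ count P + count Q
count-∨-∧ P Q = begin
  count (λ i → P i ∨ Q i) + count (λ i → P i ∧ Q i)  ≡⟨ ∑-distrib-+ (λ i → ⟦ P i ∨ Q i ⟧) (λ i → ⟦ P i ∧ Q i ⟧) ⟨
  ∑[ i < _ ] (⟦ P i ∨ Q i ⟧ + ⟦ P i ∧ Q i ⟧)         ≡⟨ sum-cong-≗ (λ i → ⟦∨⟧+⟦∧⟧ (P i) (Q i)) ⟩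
  ∑[ i < _ ] (⟦ P i ⟧ + ⟦ Q i ⟧)                     ≡⟨ ∑-distrib-+ (⟦_⟧ ∘ P) (⟦_⟧ ∘ Q) ⟩
  count P + count Q                                  ∎
  where
  open ≡-Reasoning
  ⟦∨⟧+⟦∧⟧ : ∀ a b → ⟦ a ∨ b ⟧ + ⟦ a ∧ b ⟧ ≡ ⟦ a ⟧ + ⟦ b ⟧
  ⟦∨⟧+⟦∧⟧ true true = refl
  ⟦∨⟧+⟦∧⟧ true false = refl
  ⟦∨⟧+⟦∧⟧ false true = refl
  ⟦∨⟧+⟦∧⟧ false false = refl

count-split : ∀ {n} (P Q : Fin n → Bool) →
              count P ≡ count (λ i → P i ∧ Q i) + count (λ i → P i ∧ not (Q i))
count-split P Q = trans (sum-cong-≗ (λ i → ⟦⟧-split (P i) (Q i)))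
                        (∑-distrib-+ (λ i → ⟦ P i ∧ Q i ⟧) (λ i → ⟦ P i ∧ not (Q i) ⟧))
  where
  ⟦⟧-split : ∀ a b → ⟦ a ⟧ ≡ ⟦ a ∧ b ⟧ + ⟦ a ∧ not b ⟧
  ⟦⟧-split true true = refl
  ⟦⟧-split true false = refl
  ⟦⟧-split false b = refl

count-weighted : ∀ {n} (P : Fin n → Bool) c (f : Fin n → ℕ) →
                 (∀ i → T (P i) → c ≤ f i) → count P * c ≤ sum f
count-weighted P c f bound = ≤-trans (≤-reflexive (*-distribʳ-sum c (⟦_⟧ ∘ P))) (sum-mono termwise)
  where
  termwise : ∀ i → ⟦ P i ⟧ * c ≤ f i
  termwise i with P i | bound i
  ... | true | c≤fi = ≤-trans (≤-reflexive (+-identityʳ c)) (c≤fi tt)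
  ... | false | _ = z≤n

one-of-three : ∀ {p q r} → ⟦ p ⟧ + ⟦ q ⟧ + ⟦ r ⟧ ≡ 1 →
               (T p → ¬ T q) × (T p → ¬ T r) × (T q → ¬ T r) × (¬ T p → ¬ T q → T r)
one-of-three {true} {false} {false} _ = (λ _ ()) , (λ _ ()) , (λ ()) , (λ ¬p _ → ¬p tt)
one-of-three {false} {true} {false} _ = (λ ()) , (λ ()) , (λ _ ()) , (λ _ ¬q → ¬q tt)
one-of-three {false} {false} {true} _ = (λ ()) , (λ ()) , (λ ()) , (λ _ _ → tt)
one-of-three {true} {true} {_} ()
one-of-three {true} {false} {true} ()
one-of-three {false} {true} {true} ()
one-of-three {false} {false} {false} ()

count-disjoint : ∀ {n} (P Q : Fin n → Bool) → (∀ i → T (P i) → ¬ T (Q i)) →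
                 count P + count Q ≡ count (λ i → P i ∨ Q i)
count-disjoint P Q disjoint = begin
  count P + count Q                                  ≡⟨ count-∨-∧ P Q ⟨
  count (λ i → P i ∨ Q i) + count (λ i → P i ∧ Q i)  ≡⟨ cong (count (λ i → P i ∨ Q i) +_) (count-none (λ i → P i ∧ Q i) neither) ⟩
  count (λ i → P i ∨ Q i) + 0                        ≡⟨ +-identityʳ _ ⟩
  count (λ i → P i ∨ Q i)                            ∎
  where
  open ≡-Reasoning
  neither : ∀ i → ¬ T (P i ∧ Q i)
  neither i PQ = let Pi , Qi = T-∧⁻ {P i} PQ in disjoint i Pi Qi

count-product : ∀ {n} (A B : Fin n → Bool) → count A * count B ≡ ∑[ x < n ] count (λ w → A x ∧ B w)
count-product {n} A B = trans (*-distribʳ-sum (count B) (⟦_⟧ ∘ A)) (sum-cong-≗ row)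
  where
  row : ∀ x → ⟦ A x ⟧ * count B ≡ count (λ w → A x ∧ B w)
  row x with A x
  ... | true = +-identityʳ (count B)
  ... | false = sym (count-none {n} (λ _ → false) (λ _ ()))

∈⇒T : ∀ {n} {p : Subset n} {x} → x ∈ p → T (lookup p x)
∈⇒T x∈p = subst T (sym ([]=⇒lookup x∈p)) tt

T⇒∈ : ∀ {n} {p : Subset n} {x} → T (lookup p x) → x ∈ p
T⇒∈ {p = p} {x} T-px with lookup p x in px≡true
... | true = lookup⇒[]= x p px≡true

¬T⇒∉ : ∀ {n} {p : Subset n} {x} → ¬ T (lookup p x) → x ∉ p
¬T⇒∉ ¬T-px = ¬T-px ∘ ∈⇒T

∣p∣≡count : ∀ {n} (p : Subset n) → ∣ p ∣ ≡ count (lookup p)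
∣p∣≡count [] = refl
∣p∣≡count (true ∷ p) = cong suc (∣p∣≡count p)
∣p∣≡count (false ∷ p) = ∣p∣≡count p

∣tabulate∣≡count : ∀ {n} (f : Fin n → Bool) → ∣ tabulate f ∣ ≡ count f
∣tabulate∣≡count f = trans (∣p∣≡count (tabulate f)) (count-cong (lookup∘tabulate f))

∈-tabulate⁺ : ∀ {n} {f : Fin n → Bool} {x} → T (f x) → x ∈ tabulate f
∈-tabulate⁺ {f = f} {x} T-fx = T⇒∈ (subst T (sym (lookup∘tabulate f x)) T-fx)

∈-tabulate⁻ : ∀ {n} {f : Fin n → Bool} {x} → x ∈ tabulate f → T (f x)
∈-tabulate⁻ {f = f} {x} x∈ = subst T (lookup∘tabulate f x) (∈⇒T x∈)

_==_ : ∀ {n} → Fin n → Fin n → Bool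
a == b = isYes (a Finₚ.≟ b)

==⇒≡ : ∀ {n} {a b : Fin n} → T (a == b) → a ≡ b
==⇒≡ {a = a} {b} = toWitness {a? = a Finₚ.≟ b}

≡⇒== : ∀ {n} {a b : Fin n} → a ≡ b → T (a == b)
≡⇒== {a = a} {b} = fromWitness {a? = a Finₚ.≟ b}

count-singleton : ∀ {n} (c : Fin n) → count (_== c) ≤ 1
count-singleton c = count-unique (_== c) (λ i j i≡c j≡c → trans (==⇒≡ i≡c) (sym (==⇒≡ j≡c)))

_∈?ₚ_ : ∀ {n} (e : Fin n × Fin n) (es : List (Fin n × Fin n)) → Dec (e ∈ₗ es)
e ∈?ₚ es = Any.any? (≡-dec Finₚ._≟_ Finₚ._≟_ e) es

listedIn : ∀ {n} → List (Fin n × Fin n) → Fin n → Fin n → Bool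
listedIn es u v = isYes ((u , v) ∈?ₚ es)

listed⇒∈ : ∀ {n} {es : List (Fin n × Fin n)} {u v} → T (listedIn es u v) → (u , v) ∈ₗ es
listed⇒∈ {es = es} {u} {v} = toWitness {a? = (u , v) ∈?ₚ es}

∈⇒listed : ∀ {n} {es : List (Fin n × Fin n)} {u v} → (u , v) ∈ₗ es → T (listedIn es u v)
∈⇒listed {es = es} {u} {v} = fromWitness {a? = (u , v) ∈?ₚ es}

listed-total : ∀ {n} (es : List (Fin n × Fin n)) → ∑[ a < n ] count (listedIn es a) ≤ length es
listed-total {n} [] = ≤-reflexive (trans (sum-cong-≗ (λ a → count-none {n} (listedIn [] a) (λ b ()))) (sum-zeros n))
  where
  sum-zeros : ∀ m → ∑[ a < m ] 0 ≡ 0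
  sum-zeros zero = refl
  sum-zeros (suc m) = sum-zeros m
listed-total {n} ((p , q) ∷ es) = begin
  ∑[ a < n ] count (listedIn ((p , q) ∷ es) a)
    ≤⟨ sum-mono (λ a → ≤-trans (count-mono (head-or-tail a)) (count-∨ (λ b → a == p ∧ b == q) (listedIn es a))) ⟩
  ∑[ a < n ] (count (λ b → a == p ∧ b == q) + count (listedIn es a))
    ≡⟨ ∑-distrib-+ (λ a → count (λ b → a == p ∧ b == q)) (λ a → count (listedIn es a)) ⟩
  ∑[ a < n ] count (λ b → a == p ∧ b == q) + ∑[ a < n ] count (listedIn es a)
    ≤⟨ +-mono-≤ (≤-trans (sum-mono row) (count-singleton p)) (listed-total es) ⟩
  suc (length es) ∎
  where
  open ≤-Reasoning
  head-or-tail : ∀ a b → T (listedIn ((p , q) ∷ es) a b) → T (a == p ∧ b == q ∨ listedIn es a b)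
  head-or-tail a b listed with listed⇒∈ {es = (p , q) ∷ es} listed
  ... | here refl = T-∨ˡ {a == a ∧ b == b} (T-∧⁺ {a == a} (≡⇒== refl) (≡⇒== refl))
  ... | there inTail = T-∨ʳ {a == p ∧ b == q} (∈⇒listed inTail)
  row : ∀ a → count (λ b → a == p ∧ b == q) ≤ ⟦ a == p ⟧
  row a with a Finₚ.≟ p
  ... | yes _ = count-singleton q
  ... | no _ = ≤-reflexive (count-none {n} (λ _ → false) (λ _ ()))

imageOf : ∀ {A : Set} {n} → (A → Fin n) → List A → Fin n → Bool
imageOf f xs y = isYes (Any.any? (λ x → f x Finₚ.≟ y) xs)

∈⇒image : ∀ {A : Set} {n} (f : A → Fin n) {x xs} → x ∈ₗ xs → T (imageOf f xs (f x))
∈⇒image f {x} {xs} x∈xs = fromWitness {a? = Any.any? (λ z → f z Finₚ.≟ f x) xs} (lose x∈xs refl)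

image⇒∈ : ∀ {A : Set} {n} (f : A → Fin n) {xs y} → T (imageOf f xs y) → ∃[ x ] (x ∈ₗ xs × f x ≡ y)
image⇒∈ f {xs} {y} inImage = find (toWitness {a? = Any.any? (λ x → f x Finₚ.≟ y) xs} inImage)

image-count : ∀ {A : Set} {n} (f : A → Fin n) xs → count (imageOf f xs) ≤ length xs
image-count f [] = ≤-reflexive (count-none (imageOf f []) (λ _ ()))
image-count f (x ∷ xs) = begin
  count (imageOf f (x ∷ xs))                 ≤⟨ count-mono head-or-tail ⟩
  count (λ y → y == f x ∨ imageOf f xs y)    ≤⟨ count-∨ (_== f x) (imageOf f xs) ⟩
  count (_== f x) + count (imageOf f xs)     ≤⟨ +-mono-≤ (count-singleton (f x)) (image-count f xs) ⟩
  suc (length xs)                            ∎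
  where
  open ≤-Reasoning
  head-or-tail : ∀ y → T (imageOf f (x ∷ xs) y) → T (y == f x ∨ imageOf f xs y)
  head-or-tail y inImage with image⇒∈ f {x ∷ xs} inImage
  ... | _ , here refl , fx≡y = T-∨ˡ (≡⇒== (sym fx≡y))
  ... | _ , there x'∈xs , refl = T-∨ʳ {_ == f x} (∈⇒image f x'∈xs)

length-filter-tabulate : ∀ {A : Set} {n} (P : A → Bool) (f : Fin n → A) →
                         length (filterᵇ P (tabulateₗ f)) ≡ count (P ∘ f)
length-filter-tabulate {n = zero} P f = refl
length-filter-tabulate {n = suc n} P f with P (f zero)
... | true = cong suc (length-filter-tabulate P (f ∘ suc))
... | false = length-filter-tabulate P (f ∘ suc)

+-double : ∀ x → x + x ≡ 2 * x
+-double = solve-∀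

2h<k : ∀ {h k} → 1 ≤ k → h ≤ ⌊ k ∸ 1 /2⌋ → 2 * h < k
2h<k {h} {suc k} _ h≤ = s≤s (begin
  2 * h                   ≡⟨ +-double h ⟨
  h + h                   ≤⟨ +-mono-≤ h≤ (≤-trans h≤ (⌊n/2⌋≤⌈n/2⌉ k)) ⟩
  ⌊ k /2⌋ + ⌈ k /2⌉       ≡⟨ ⌊n/2⌋+⌈n/2⌉≡n k ⟩
  k                       ∎)
  where open ≤-Reasoning

-- For positive a and b, a + b ≤ a·b + 1, since (a - 1)(b - 1) ≥ 0.
+≤*+1 : ∀ {a b} → 1 ≤ a → 1 ≤ b → a + b ≤ a * b + 1
+≤*+1 {suc a} {suc b} _ _ = begin
  suc a + suc b          ≡⟨ expand a b ⟩
  (a + b + 2) + 0        ≤⟨ +-monoʳ-≤ (a + b + 2) z≤n ⟩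
  (a + b + 2) + a * b    ≡⟨ regroup a b ⟩
  suc a * suc b + 1      ∎
  where
  open ≤-Reasoning
  expand : ∀ a b → suc a + suc b ≡ (a + b + 2) + 0
  expand = solve-∀
  regroup : ∀ a b → (a + b + 2) + a * b ≡ suc a * suc b + 1
  regroup = solve-∀

three-parts-bound : ∀ {a b s h t} → 1 ≤ a → 1 ≤ b → a * b ≤ h → s < t → a + s + b ≤ t + h
three-parts-bound {a} {b} {s} {h} {t} 1≤a 1≤b ab≤h s<t = begin
  a + s + b      ≡⟨ reorder a s b ⟩
  (a + b) + s    ≤⟨ +-monoˡ-≤ s (≤-trans (+≤*+1 1≤a 1≤b) (+-monoˡ-≤ 1 ab≤h)) ⟩
  (h + 1) + s    ≡⟨ shift h s ⟩
  suc s + h      ≤⟨ +-monoˡ-≤ h s<t ⟩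
  t + h          ∎
  where
  open ≤-Reasoning
  reorder : ∀ a s b → a + s + b ≡ (a + b) + s
  reorder = solve-∀
  shift : ∀ h s → (h + 1) + s ≡ suc s + h
  shift = solve-∀

-- If m ≥ s + 3 and m·k ≤ s·k + 2h + 2m with k ≥ 2, then the s + 3 part of m
-- already forces 3k ≤ 2h + 2s + 6 (the remaining m - (s + 3) vertices only
-- help, as each contributes k ≥ 2 on the left and 2 on the right).
excess-bound : ∀ {m s k h} → 2 ≤ k → s + 3 ≤ m → m * k ≤ s * k + 2 * h + 2 * m →
               3 * k ≤ 2 * h + 2 * s + 6
excess-bound {m} {s} {k} {h} 2≤k s+3≤m mk≤ = +-cancelʳ-≤ (2 * e) _ _ (+-cancelˡ-≤ (s * k) _ _ (begin
  s * k + (3 * k + 2 * e)                ≤⟨ +-monoʳ-≤ (s * k) (+-monoʳ-≤ (3 * k) 2e≤ek) ⟩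
  s * k + (3 * k + e * k)                ≡⟨ expand s e k ⟩
  (s + 3 + e) * k                        ≡⟨ cong (_* k) m≡ ⟨
  m * k                                  ≤⟨ mk≤ ⟩
  s * k + 2 * h + 2 * m                  ≡⟨ cong (λ x → s * k + 2 * h + 2 * x) m≡ ⟩
  s * k + 2 * h + 2 * (s + 3 + e)        ≡⟨ expand′ s h e k ⟩
  s * k + ((2 * h + 2 * s + 6) + 2 * e)  ∎))
  where
  open ≤-Reasoning
  e : ℕ
  e = m ∸ (s + 3)
  m≡ : m ≡ s + 3 + e
  m≡ = sym (m+[n∸m]≡n s+3≤m)
  2e≤ek : 2 * e ≤ e * k
  2e≤ek = ≤-trans (≤-reflexive (*-comm 2 e)) (*-monoʳ-≤ e 2≤k)
  expand : ∀ s e k → s * k + (3 * k + e * k) ≡ (s + 3 + e) * k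
  expand = solve-∀
  expand′ : ∀ s h e k → s * k + 2 * h + 2 * (s + 3 + e) ≡ s * k + ((2 * h + 2 * s + 6) + 2 * e)
  expand′ = solve-∀

-- The numerical core of the case where every vertex outside F₁ ∪ F₂ has a
-- neighbour in F₁ △ F₂: with m such vertices, u = |F₁ ∪ F₂| and
-- s = |F₁ ∩ F₂|, the two edge counts below cannot both hold.
edge-counts-impossible : ∀ {m u s k h t} → 3 ≤ k → 2 * h < k → t + h ≡ k →
  2 * t + 3 ≤ m + u → u + s ≤ 2 * t →
  m * k ≤ u * k + 2 * h → m * k ≤ s * k + 2 * h + 2 * m → ⊥
edge-counts-impossible {m} {u} {s} {k} {h} {t} 3≤k 2h<k t+h≡k enough u+s≤2t mk≤uk mk≤sk =
  <-irrefl refl (+-cancelˡ-< (2 * k) k k (begin-strict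
    2 * k + k                ≡⟨ solve-3k k ⟩
    3 * k                    ≤⟨ excess-bound {m} {s} {k} {h} (≤-trans (s≤s (s≤s z≤n)) 3≤k) s+3≤m mk≤sk ⟩
    2 * h + 2 * s + 6        ≡⟨ regroup h s ⟩
    2 * h + 2 * (2 + s) + 2  ≤⟨ +-monoˡ-≤ 2 (+-monoʳ-≤ (2 * h) (*-monoʳ-≤ 2 2+s≤t)) ⟩
    2 * h + 2 * t + 2        ≡⟨ cong (_+ 2) (*-distribˡ-+ 2 h t) ⟨
    2 * (h + t) + 2          ≡⟨ cong (λ x → 2 * x + 2) (trans (+-comm h t) t+h≡k) ⟩
    2 * k + 2                <⟨ +-monoʳ-< (2 * k) 3≤k ⟩
    2 * k + k                ∎))
  where
  open ≤-Reasoning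
  solve-3k : ∀ k → 2 * k + k ≡ 3 * k
  solve-3k = solve-∀
  regroup : ∀ h s → 2 * h + 2 * s + 6 ≡ 2 * h + 2 * (2 + s) + 2
  regroup = solve-∀

  -- fewer than k deleted edges per vertex on average: m ≤ u
  m≤u : m ≤ u
  m≤u = ≤-pred (*-cancelʳ-< k m (suc u) (begin-strict
    m * k          ≤⟨ mk≤uk ⟩
    u * k + 2 * h  <⟨ +-monoʳ-< (u * k) 2h<k ⟩
    u * k + k      ≡⟨ +-comm (u * k) k ⟩
    suc u * k      ∎))

  s+3≤m : s + 3 ≤ m
  s+3≤m = +-cancelʳ-≤ u (s + 3) m (begin
    s + 3 + u      ≡⟨ reorder s u ⟩
    (u + s) + 3    ≤⟨ +-monoˡ-≤ 3 u+s≤2t ⟩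
    2 * t + 3      ≤⟨ enough ⟩
    m + u          ∎)
    where
    reorder : ∀ s u → s + 3 + u ≡ (u + s) + 3
    reorder = solve-∀

  -- 2t + 3 ≤ m + u ≤ 2u and u ≤ 2t - s give 2s + 3 ≤ 2t
  2+s≤t : 2 + s ≤ t
  2+s≤t = *-cancelˡ-< 2 (suc s) t (+-cancelˡ-≤ (2 * t) _ _ (begin
    2 * t + suc (2 * suc s)  ≡⟨ reorder t s ⟩
    (2 * t + 3) + 2 * s      ≤⟨ +-monoˡ-≤ (2 * s) (≤-trans enough (+-monoˡ-≤ u m≤u)) ⟩
    (u + u) + 2 * s          ≡⟨ double u s ⟩
    2 * (u + s)              ≤⟨ *-monoʳ-≤ 2 u+s≤2t ⟩
    2 * (2 * t)              ≡⟨ double′ t ⟩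
    2 * t + 2 * t            ∎))
    where
    reorder : ∀ t s → 2 * t + suc (2 * suc s) ≡ (2 * t + 3) + 2 * s
    reorder = solve-∀
    double : ∀ u s → (u + u) + 2 * s ≡ 2 * (u + s)
    double = solve-∀
    double′ : ∀ t → 2 * (2 * t) ≡ 2 * t + 2 * t
    double′ = solve-∀

edge-sym : ∀ {n} (G : SimpleGraph n) {u v} → Edge G u v → Edge G v u
edge-sym G {u} {v} = subst T (adj-sym G u v)

no-loop : ∀ {n} (G : SimpleGraph n) {v} → ¬ Edge G v v
no-loop G {v} = subst T (adj-irref G v)

module RegularGraph {n : ℕ} (G : SimpleGraph n) {k : ℕ} (regular : Regular G k) where

  degree : ∀ v → count (adj G v) ≡ k
  degree v = trans (sym (∣tabulate∣≡count (adj G v))) (regular v)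

  edges-into : (X : Fin n → Bool) → ∑[ w < n ] count (λ y → adj G w y ∧ X y) ≡ count X * k
  edges-into X = begin
    ∑[ w < n ] ∑[ y < n ] ⟦ adj G w y ∧ X y ⟧  ≡⟨ ∑-comm (λ w y → ⟦ adj G w y ∧ X y ⟧) ⟩
    ∑[ y < n ] ∑[ w < n ] ⟦ adj G w y ∧ X y ⟧  ≡⟨ sum-cong-≗ column ⟩
    ∑[ y < n ] (⟦ X y ⟧ * k)                   ≡⟨ *-distribʳ-sum k (⟦_⟧ ∘ X) ⟨
    count X * k                                ∎
    where
    open ≡-Reasoning
    column : ∀ y → ∑[ w < n ] ⟦ adj G w y ∧ X y ⟧ ≡ ⟦ X y ⟧ * k
    column y with X y
    ... | true = begin
      ∑[ w < n ] ⟦ adj G w y ∧ true ⟧  ≡⟨ count-cong (λ w → trans (∧-identityʳ (adj G w y)) (adj-sym G w y)) ⟩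
      count (adj G y)                  ≡⟨ degree y ⟩
      k                                ≡⟨ +-identityʳ k ⟨
      1 * k                            ∎
    ... | false = count-none (λ w → adj G w y ∧ false) (λ w → subst T (∧-zeroʳ (adj G w y)))

record Crossing {n : ℕ} (G : SimpleGraph n) (S : Subset n) (A : Fin n → Bool) : Set where
  field
    inner outer : Fin n
    inner∈A : T (A inner)
    outer∉A : ¬ T (A outer)
    inner∉S : inner ∉ S
    outer∉S : outer ∉ S
    edge : Edge G inner outer

walk-start : ∀ {n} {G : SimpleGraph n} {S u v} → WalkAvoiding G S u v → u ∉ S
walk-start (here u∉S) = u∉S
walk-start (step u∉S _ _) = u∉S

crossing : ∀ {n} {G : SimpleGraph n} {S : Subset n} (A : Fin n → Bool) {u v} →
           WalkAvoiding G S u v → T (A u) → ¬ T (A v) → Crossing G S A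
crossing A (here _) u∈A u∉A = ⊥-elim (u∉A u∈A)
crossing A (step {u} {w} u∉S uw rest) u∈A v∉A with A w in Aw
... | true = crossing A rest (subst T (sym Aw) tt) v∉A
... | false = record
  { inner = u ; outer = w ; inner∈A = u∈A ; outer∉A = subst T Aw
  ; inner∉S = u∉S ; outer∉S = walk-start rest ; edge = uw }

module Deletion {n : ℕ} (G : SimpleGraph n) (Fe : List (Fin n × Fin n)) where

  deleted : Fin n → Fin n → Bool
  deleted u v = listedIn Fe u v ∨ listedIn Fe v u

  survives : Fin n → Fin n → Bool
  survives u v = adj G u v ∧ not (deleted u v)

  edge⇒survives : ∀ {u v} → EdgeDeleted G Fe u v → T (survives u v)
  edge⇒survives {u} {v} (uv , ¬uv∈ , ¬vu∈) = T-∧⁺ {adj G u v} uv (T-not⁺ notDeleted)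
    where
    notDeleted : ¬ T (deleted u v)
    notDeleted del with T-∨⁻ {listedIn Fe u v} del
    ... | inj₁ uv-listed = ¬uv∈ (listed⇒∈ uv-listed)
    ... | inj₂ vu-listed = ¬vu∈ (listed⇒∈ vu-listed)

  survives⇒edge : ∀ {u v} → T (survives u v) → EdgeDeleted G Fe u v
  survives⇒edge {u} {v} s with T-∧⁻ {adj G u v} s
  ... | uv , ¬del = uv , (λ m → T-not⁻ ¬del (T-∨ˡ (∈⇒listed m)))
                       , (λ m → T-not⁻ ¬del (T-∨ʳ {listedIn Fe u v} (∈⇒listed m)))

  edge? : ∀ u v → Dec (EdgeDeleted G Fe u v)
  edge? u v = map′ survives⇒edge edge⇒survives (T? (survives u v))

  survives⇒adj : ∀ {u v} → T (survives u v) → Edge G u v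
  survives⇒adj {u} {v} = proj₁ ∘ T-∧⁻ {adj G u v}

  survives-sym : ∀ {u v} → T (survives u v) → T (survives v u)
  survives-sym {u} {v} = subst T (cong₂ (λ a d → a ∧ not d) (adj-sym G u v) (∨-comm (listedIn Fe u v) _))

  -- Each pair of Fe removes one edge, counted once from each endpoint.
  deleted-total : ∑[ w < n ] count (deleted w) ≤ length Fe + length Fe
  deleted-total = begin
    ∑[ w < n ] count (deleted w)
      ≤⟨ sum-mono (λ w → count-∨ (listedIn Fe w) (λ y → listedIn Fe y w)) ⟩
    ∑[ w < n ] (count (listedIn Fe w) + count (λ y → listedIn Fe y w))
      ≡⟨ ∑-distrib-+ (λ w → count (listedIn Fe w)) (λ w → count (λ y → listedIn Fe y w)) ⟩
    ∑[ w < n ] count (listedIn Fe w) + ∑[ w < n ] count (λ y → listedIn Fe y w)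
      ≡⟨ cong (∑[ w < n ] count (listedIn Fe w) +_) (∑-comm (λ w y → ⟦ listedIn Fe y w ⟧)) ⟩
    ∑[ w < n ] count (listedIn Fe w) + ∑[ y < n ] count (listedIn Fe y)
      ≤⟨ +-mono-≤ (listed-total Fe) (listed-total Fe) ⟩
    length Fe + length Fe ∎
    where open ≤-Reasoning

  record DeletionCover (x w : Fin n) : Set where
    field
      cover : Fin n → Bool
      cover-size : count cover ≤ length Fe
      x∉cover : ¬ T (cover x)
      w∉cover : ¬ T (cover w)
      meets : ∀ {p q} → Edge G p q → T (deleted p q) → T (cover p) ⊎ T (cover q)

  -- If x and w are non-adjacent, every edge pq of G has an endpoint outside
  -- {x, w}: if p is x or w then q is neither (no loops, x ≁ w).  Picking such
  -- an endpoint for each listed edge gives the cover.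
  deletion-cover : ∀ x w → ¬ Edge G x w → DeletionCover x w
  deletion-cover x w x≁w = record
    { cover = cover
    ; cover-size = ≤-trans (image-count pick listedEdges) (length-filter isEdge? Fe)
    ; x∉cover = λ x∈ → proj₁ (covered-avoids x∈) refl
    ; w∉cover = λ w∈ → proj₂ (covered-avoids w∈) refl
    ; meets = meets
    }
    where
    isEdge? : Decidable (λ (e : Fin n × Fin n) → Edge G (proj₁ e) (proj₂ e))
    isEdge? (p , q) = T? (adj G p q)

    listedEdges : List (Fin n × Fin n)
    listedEdges = filter isEdge? Fe

    pick : Fin n × Fin n → Fin n
    pick (p , q) with p Finₚ.≟ x | p Finₚ.≟ w
    ... | no _ | no _ = p
    ... | _ | _ = q

    pick-end : ∀ p q → pick (p , q) ≡ p ⊎ pick (p , q) ≡ q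
    pick-end p q with p Finₚ.≟ x | p Finₚ.≟ w
    ... | no _ | no _ = inj₁ refl
    ... | yes _ | _ = inj₂ refl
    ... | no _ | yes _ = inj₂ refl

    pick-avoids : ∀ {p q} → Edge G p q → pick (p , q) ≢ x × pick (p , q) ≢ w
    pick-avoids {p} {q} pq with p Finₚ.≟ x | p Finₚ.≟ w
    ... | no p≢x | no p≢w = p≢x , p≢w
    ... | yes refl | _ = (λ { refl → no-loop G pq }) , (λ { refl → x≁w pq })
    ... | no _ | yes refl = (λ { refl → x≁w (edge-sym G pq) }) , (λ { refl → no-loop G pq })

    cover : Fin n → Bool
    cover = imageOf pick listedEdges

    covered-avoids : ∀ {y} → T (cover y) → y ≢ x × y ≢ w
    covered-avoids y∈ with image⇒∈ pick y∈
    ... | _ , e∈ , refl = pick-avoids (proj₂ (∈-filter⁻ isEdge? {xs = Fe} e∈))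

    picked-end : ∀ {p q} → Edge G p q → (p , q) ∈ₗ Fe → T (cover p) ⊎ T (cover q)
    picked-end {p} {q} pq pq∈Fe with pick-end p q | ∈⇒image pick (∈-filter⁺ isEdge? pq∈Fe pq)
    ... | inj₁ pick≡p | inCover = inj₁ (subst (T ∘ cover) pick≡p inCover)
    ... | inj₂ pick≡q | inCover = inj₂ (subst (T ∘ cover) pick≡q inCover)

    meets : ∀ {p q} → Edge G p q → T (deleted p q) → T (cover p) ⊎ T (cover q)
    meets {p} {q} pq del with T-∨⁻ {listedIn Fe p q} del
    ... | inj₁ pq-listed = picked-end pq (listed⇒∈ pq-listed)
    ... | inj₂ qp-listed = swap (picked-end (edge-sym G pq) (listed⇒∈ qp-listed))

  -- If all pairs between two disjoint sets A and B are deleted edges, then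
  -- |A|·|B| ≤ |Fe|: each listed pair (p , q) accounts for at most one of
  -- the pairs (p , q), (q , p) between A and B.
  deleted-between : (A B : Fin n → Bool) → (∀ y → T (A y) → ¬ T (B y)) →
                    (∀ x w → T (A x) → T (B w) → T (deleted x w)) → count A * count B ≤ length Fe
  deleted-between A B disjoint allDeleted = begin
    count A * count B
      ≡⟨ count-product A B ⟩
    ∑[ x < n ] count (λ w → A x ∧ B w)
      ≤⟨ sum-mono (λ x → ≤-trans (count-mono (listed-either-way x)) (count-∨ (forward x) (backward x))) ⟩
    ∑[ x < n ] (count (forward x) + count (backward x))
      ≡⟨ ∑-distrib-+ (count ∘ forward) (count ∘ backward) ⟩
    ∑[ x < n ] count (forward x) + ∑[ x < n ] count (backward x)
      ≡⟨ cong (∑[ x < n ] count (forward x) +_) (∑-comm (λ x w → ⟦ backward x w ⟧)) ⟩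
    ∑[ p < n ] count (forward p) + ∑[ p < n ] count (λ q → backward q p)
      ≡⟨ ∑-distrib-+ (count ∘ forward) (λ p → count (λ q → backward q p)) ⟨
    ∑[ p < n ] (count (forward p) + count (λ q → backward q p))
      ≡⟨ sum-cong-≗ (λ p → count-disjoint (forward p) (λ q → backward q p) (not-both p)) ⟩
    ∑[ p < n ] count (λ q → forward p q ∨ backward q p)
      ≤⟨ sum-mono (λ p → count-mono (λ q → listed-pair p q)) ⟩
    ∑[ p < n ] count (listedIn Fe p)
      ≤⟨ listed-total Fe ⟩
    length Fe ∎
    where
    open ≤-Reasoning
    forward backward : Fin n → Fin n → Bool
    forward x w = (A x ∧ B w) ∧ listedIn Fe x w
    backward x w = (A x ∧ B w) ∧ listedIn Fe w x

    listed-either-way : ∀ x w → T (A x ∧ B w) → T (forward x w ∨ backward x w)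
    listed-either-way x w AB with T-∧⁻ {A x} AB
    ... | Ax , Bw with T-∨⁻ {listedIn Fe x w} (allDeleted x w Ax Bw)
    ...   | inj₁ xw = T-∨ˡ (T-∧⁺ {A x ∧ B w} AB xw)
    ...   | inj₂ wx = T-∨ʳ {forward x w} (T-∧⁺ {A x ∧ B w} AB wx)

    not-both : ∀ p q → T (forward p q) → ¬ T (backward q p)
    not-both p q fwd bwd = disjoint p (proj₁ (T-∧⁻ {A p} (proj₁ (T-∧⁻ {A p ∧ B q} fwd))))
                                      (proj₂ (T-∧⁻ {A q} (proj₁ (T-∧⁻ {A q ∧ B p} bwd))))

    listed-pair : ∀ p q → T (forward p q ∨ backward q p) → T (listedIn Fe p q)
    listed-pair p q fwd∨bwd with T-∨⁻ {forward p q} fwd∨bwd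
    ... | inj₁ fwd = proj₂ (T-∧⁻ {A p ∧ B q} fwd)
    ... | inj₂ bwd = proj₂ (T-∧⁻ {A q ∧ B p} bwd)

  degree-split : ∀ {k} → Regular G k → ∀ w (X : Fin n → Bool) →
    k ≤ count (λ y → adj G w y ∧ X y) + count (deleted w) + count (λ y → survives w y ∧ not (X y))
  degree-split {k} regular w X = begin
    k                ≡⟨ RegularGraph.degree G regular w ⟨
    count (adj G w)  ≤⟨ count-mono (λ y → trichotomy (adj G w y) (X y) (deleted w y)) ⟩
    count (λ y → inX y ∨ (deleted w y ∨ outside y))
      ≤⟨ ≤-trans (count-∨ inX _) (+-monoʳ-≤ (count inX) (count-∨ (deleted w) outside)) ⟩
    count inX + (count (deleted w) + count outside)  ≡⟨ +-assoc (count inX) _ _ ⟨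
    count inX + count (deleted w) + count outside    ∎
    where
    open ≤-Reasoning
    inX outside : Fin n → Bool
    inX y = adj G w y ∧ X y
    outside y = survives w y ∧ not (X y)
    trichotomy : ∀ e x d → T e → T ((e ∧ x) ∨ (d ∨ ((e ∧ not d) ∧ not x)))
    trichotomy true true d _ = tt
    trichotomy true false true _ = tt
    trichotomy true false false _ = tt

Condition₁ Condition₂ Condition₃ : ∀ {n} → (Fin n → Fin n → Set) → Subset n → Subset n → Set
Condition₁ E F₁ F₂ =
  ∃[ u ] ∃[ w ] ∃[ v ]
    (u ∉ F₁ × u ∉ F₂) × (w ∉ F₁ × w ∉ F₂) ×
    ((v ∈ F₁ × v ∉ F₂) ⊎ (v ∈ F₂ × v ∉ F₁)) × E u v × E u w
Condition₂ E F₁ F₂ =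
  ∃[ u ] ∃[ v ] ∃[ w ]
    u ≢ v × (u ∈ F₁ × u ∉ F₂) × (v ∈ F₁ × v ∉ F₂) × (w ∉ F₁ × w ∉ F₂) × E u w × E v w
Condition₃ E F₁ F₂ =
  ∃[ u ] ∃[ v ] ∃[ w ]
    u ≢ v × (u ∈ F₂ × u ∉ F₁) × (v ∈ F₂ × v ∉ F₁) × (w ∉ F₁ × w ∉ F₂) × E u w × E v w

module _ {n : ℕ} {E : Fin n → Fin n → Set} (E? : ∀ u v → Dec (E u v)) (F₁ F₂ : Subset n) where

  private
    outside? : ∀ w → Dec (w ∉ F₁ × w ∉ F₂)
    outside? w = ¬? (w ∈? F₁) ×-dec ¬? (w ∈? F₂)

    only? : ∀ (F F′ : Subset n) v → Dec (v ∈ F × v ∉ F′)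
    only? F F′ v = (v ∈? F) ×-dec ¬? (v ∈? F′)

  condition₁? : Dec (Condition₁ E F₁ F₂)
  condition₁? = Finₚ.any? λ u → Finₚ.any? λ w → Finₚ.any? λ v →
    outside? u ×-dec outside? w ×-dec (only? F₁ F₂ v ⊎-dec only? F₂ F₁ v) ×-dec E? u v ×-dec E? u w

  condition₂? : Dec (Condition₂ E F₁ F₂)
  condition₂? = Finₚ.any? λ u → Finₚ.any? λ v → Finₚ.any? λ w →
    ¬? (u Finₚ.≟ v) ×-dec only? F₁ F₂ u ×-dec only? F₁ F₂ v ×-dec outside? w ×-dec E? u w ×-dec E? v w

  condition₃? : Dec (Condition₃ E F₁ F₂)
  condition₃? = Finₚ.any? λ u → Finₚ.any? λ v → Finₚ.any? λ w →
    ¬? (u Finₚ.≟ v) ×-dec only? F₂ F₁ u ×-dec only? F₂ F₁ v ×-dec outside? w ×-dec E? u w ×-dec E? v w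

diagnosable-by-refutation : ∀ {n} {E : Fin n → Fin n → Set} → (∀ u v → Dec (E u v)) → ∀ t →
  (∀ F₁ F₂ → F₁ ≢ F₂ → ∣ F₁ ∣ ≤ t → ∣ F₂ ∣ ≤ t →
     ¬ Condition₁ E F₁ F₂ → ¬ Condition₂ E F₁ F₂ → ¬ Condition₃ E F₁ F₂ → ⊥) →
  Diagnosable n E t
diagnosable-by-refutation E? t refute F₁ F₂ F₁≢F₂ |F₁|≤t |F₂|≤t
  with condition₁? E? F₁ F₂ | condition₂? E? F₁ F₂ | condition₃? E? F₁ F₂
... | yes c₁ | _ | _ = inj₁ c₁
... | no _ | yes c₂ | _ = inj₂ (inj₁ c₂)
... | no _ | no _ | yes c₃ = inj₂ (inj₂ c₃)
... | no ¬c₁ | no ¬c₂ | no ¬c₃ = ⊥-elim (refute F₁ F₂ F₁≢F₂ |F₁|≤t |F₂|≤t ¬c₁ ¬c₂ ¬c₃)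

module IndistinguishablePair
  {n : ℕ} (G : SimpleGraph n) (Fe : List (Fin n × Fin n)) {k h t : ℕ}
  (regular : Regular G k) (connected : Connected G k) (3≤k : 3 ≤ k) (2h<k : 2 * h < k)
  (t+h≡k : t + h ≡ k) (enough-vertices : 2 * t + 3 ≤ n) (|Fe|≤h : length Fe ≤ h)
  (F₁ F₂ : Subset n) (F₁≢F₂ : F₁ ≢ F₂) (|F₁|≤t : ∣ F₁ ∣ ≤ t) (|F₂|≤t : ∣ F₂ ∣ ≤ t)
  (¬C₁ : ¬ Condition₁ (EdgeDeleted G Fe) F₁ F₂)
  (¬C₂ : ¬ Condition₂ (EdgeDeleted G Fe) F₁ F₂)
  (¬C₃ : ¬ Condition₃ (EdgeDeleted G Fe) F₁ F₂)
  where

  open Deletion G Fe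

  in₁ in₂ : Fin n → Bool
  in₁ = lookup F₁
  in₂ = lookup F₂

  common only₁ only₂ differ healthy : Fin n → Bool
  common y = in₁ y ∧ in₂ y
  only₁ y = in₁ y ∧ not (in₂ y)
  only₂ y = in₂ y ∧ not (in₁ y)
  differ y = only₁ y ∨ only₂ y
  healthy y = not (in₁ y ∨ in₂ y)

  s : ℕ
  s = count common

  healthy⇒∉ : ∀ {y} → T (healthy y) → y ∉ F₁ × y ∉ F₂
  healthy⇒∉ {y} hy = (λ y∈ → T-not⁻ hy (T-∨ˡ (∈⇒T y∈))) , (λ y∈ → T-not⁻ hy (T-∨ʳ {in₁ y} (∈⇒T y∈)))

  only⇒∈∉ : ∀ (F F′ : Subset n) {y} → T (lookup F y ∧ not (lookup F′ y)) → y ∈ F × y ∉ F′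
  only⇒∈∉ F F′ {y} o = let y∈F , y∉F′ = T-∧⁻ {lookup F y} o in T⇒∈ y∈F , ¬T⇒∉ (T-not⁻ y∉F′)

  no-healthy-pair : ∀ {u w v} → T (healthy u) → T (healthy w) → T (differ v) →
                    T (survives u v) → T (survives u w) → ⊥
  no-healthy-pair {v = v} hu hw dv uv uw = ¬C₁ (_ , _ , _ , healthy⇒∉ hu , healthy⇒∉ hw , differs , survives⇒edge uv , survives⇒edge uw)
    where
    differs : (v ∈ F₁ × v ∉ F₂) ⊎ (v ∈ F₂ × v ∉ F₁)
    differs with T-∨⁻ {only₁ v} dv
    ... | inj₁ o₁ = inj₁ (only⇒∈∉ F₁ F₂ o₁)
    ... | inj₂ o₂ = inj₂ (only⇒∈∉ F₂ F₁ o₂)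

  one-neighbour-only₁ : ∀ {w} → T (healthy w) → count (λ y → survives w y ∧ only₁ y) ≤ 1
  one-neighbour-only₁ {w} hw = count-unique _ λ u v wu wv → decidable-stable (u Finₚ.≟ v) λ u≢v →
    let wu-survives , u-only = T-∧⁻ {survives w u} wu
        wv-survives , v-only = T-∧⁻ {survives w v} wv
    in ¬C₂ (u , v , w , u≢v , only⇒∈∉ F₁ F₂ u-only , only⇒∈∉ F₁ F₂ v-only , healthy⇒∉ hw ,
            survives⇒edge (survives-sym wu-survives) , survives⇒edge (survives-sym wv-survives))

  one-neighbour-only₂ : ∀ {w} → T (healthy w) → count (λ y → survives w y ∧ only₂ y) ≤ 1
  one-neighbour-only₂ {w} hw = count-unique _ λ u v wu wv → decidable-stable (u Finₚ.≟ v) λ u≢v →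
    let wu-survives , u-only = T-∧⁻ {survives w u} wu
        wv-survives , v-only = T-∧⁻ {survives w v} wv
    in ¬C₃ (u , v , w , u≢v , only⇒∈∉ F₂ F₁ u-only , only⇒∈∉ F₂ F₁ v-only , healthy⇒∉ hw ,
            survives⇒edge (survives-sym wu-survives) , survives⇒edge (survives-sym wv-survives))

  some-difference : ∃[ x ] T (differ x)
  some-difference with Finₚ.any? (λ x → T? (differ x))
  ... | yes found = found
  ... | no none = ⊥-elim (F₁≢F₂ (begin
    F₁                   ≡⟨ tabulate∘lookup F₁ ⟨
    tabulate in₁         ≡⟨ tabulate-cong (λ x → agree (in₁ x) (in₂ x) (λ d → none (x , d))) ⟩
    tabulate in₂         ≡⟨ tabulate∘lookup F₂ ⟩
    F₂                   ∎))
    where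
    open ≡-Reasoning
    agree : ∀ a b → ¬ T ((a ∧ not b) ∨ (b ∧ not a)) → a ≡ b
    agree true true _ = refl
    agree true false differs = ⊥-elim (differs tt)
    agree false true differs = ⊥-elim (differs tt)
    agree false false _ = refl

  s<t : s < t
  s<t with some-difference
  ... | x , dx with T-∨⁻ {only₁ x} dx
  ...   | inj₁ o₁ = <-≤-trans (m<m+n s (count-pos only₁ x o₁)) (begin
    s + count only₁  ≡⟨ count-split in₁ in₂ ⟨
    count in₁        ≡⟨ ∣p∣≡count F₁ ⟨
    ∣ F₁ ∣           ≤⟨ |F₁|≤t ⟩
    t                ∎)
    where open ≤-Reasoning
  ...   | inj₂ o₂ = <-≤-trans (m<m+n s (count-pos only₂ x o₂)) (begin
    s + count only₂                          ≡⟨ cong (_+ count only₂) (count-cong (λ y → ∧-comm (in₁ y) (in₂ y))) ⟩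
    count (λ y → in₂ y ∧ in₁ y) + count only₂ ≡⟨ count-split in₂ in₁ ⟨
    count in₂                                ≡⟨ ∣p∣≡count F₂ ⟨
    ∣ F₂ ∣                                   ≤⟨ |F₂|≤t ⟩
    t                                        ∎)
    where open ≤-Reasoning

  seesDifference? : ∀ y → Dec (∃[ z ] T (differ z ∧ survives y z))
  seesDifference? y = Finₚ.any? λ z → T? (differ z ∧ survives y z)

  seesDifference : Fin n → Bool
  seesDifference y = isYes (seesDifference? y)

  seen-difference : ∀ {y} → T (seesDifference y) → ∃[ z ] T (differ z ∧ survives y z)
  seen-difference {y} = toWitness {a? = seesDifference? y}

  sees-difference : ∀ {y z} → T (differ z) → T (survives y z) → T (seesDifference y)
  sees-difference {y} {z} dz yz = fromWitness {a? = seesDifference? y} (z , T-∧⁺ {differ z} dz yz)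

  near far : Fin n → Bool
  near y = differ y ∨ (healthy y ∧ seesDifference y)
  far y = healthy y ∧ not (seesDifference y)

  exactly-one : ∀ y → ⟦ near y ⟧ + ⟦ common y ⟧ + ⟦ far y ⟧ ≡ 1
  exactly-one y = by-cases (in₁ y) (in₂ y) (seesDifference y)
    where
    by-cases : ∀ a b σ → ⟦ ((a ∧ not b) ∨ (b ∧ not a)) ∨ (not (a ∨ b) ∧ σ) ⟧ + ⟦ a ∧ b ⟧
                         + ⟦ not (a ∨ b) ∧ not σ ⟧ ≡ 1
    by-cases true true σ = refl
    by-cases true false σ = refl
    by-cases false true σ = refl
    by-cases false false true = refl
    by-cases false false false = refl

  near⇒¬common : ∀ {y} → T (near y) → ¬ T (common y)
  near⇒¬common {y} = proj₁ (one-of-three (exactly-one y))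

  near⇒¬far : ∀ {y} → T (near y) → ¬ T (far y)
  near⇒¬far {y} = proj₁ (proj₂ (one-of-three (exactly-one y)))

  far⇒¬common : ∀ {y} → T (far y) → ¬ T (common y)
  far⇒¬common {y} fy cy = proj₁ (proj₂ (proj₂ (one-of-three (exactly-one y)))) cy fy

  not-near-nor-common⇒far : ∀ {y} → ¬ T (near y) → ¬ T (common y) → T (far y)
  not-near-nor-common⇒far {y} = proj₂ (proj₂ (proj₂ (one-of-three (exactly-one y))))

  partition : count near + s + count far ≡ n
  partition = begin
    count near + s + count far                 ≡⟨ cong (_+ count far) (∑-distrib-+ (⟦_⟧ ∘ near) (⟦_⟧ ∘ common)) ⟨
    ∑[ y < n ] (⟦ near y ⟧ + ⟦ common y ⟧) + count far
      ≡⟨ ∑-distrib-+ (λ y → ⟦ near y ⟧ + ⟦ common y ⟧) (⟦_⟧ ∘ far) ⟨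
    ∑[ y < n ] (⟦ near y ⟧ + ⟦ common y ⟧ + ⟦ far y ⟧)  ≡⟨ sum-ones exactly-one ⟩
    n                                          ∎
    where open ≡-Reasoning

  -- No edge of G - Fe joins `near` to `far`: a far vertex does not see
  -- F₁ △ F₂, and a healthy near vertex seeing F₁ △ F₂ has no healthy
  -- neighbour by alternative (1).
  separated : ∀ {p q} → T (near p) → T (far q) → ¬ T (survives p q)
  separated {p} {q} np fq pq with T-∧⁻ {healthy q} fq
  ... | hq , blind with T-∨⁻ {differ p} np
  ...   | inj₁ dp = T-not⁻ blind (sees-difference dp (survives-sym pq))
  ...   | inj₂ hp-sees with T-∧⁻ {healthy p} hp-sees
  ...     | hp , sees with seen-difference sees
  ...       | z , dz-pz with T-∧⁻ {differ z} dz-pz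
  ...         | dz , pz = no-healthy-pair hp hq dz pz pq

  x₀ : Fin n
  x₀ = proj₁ some-difference

  near-x₀ : T (near x₀)
  near-x₀ = T-∨ˡ (proj₂ some-difference)

  -- A near vertex x and a far vertex w cannot be non-adjacent in G: S
  -- together with a cover of the deleted edges avoiding x and w has fewer
  -- than s + h + 1 ≤ k vertices, so a walk from x to w avoids it; where the
  -- walk leaves `near` it uses an edge of G - Fe from near to far.
  nonadjacent-impossible : ∀ {x w} → T (near x) → T (far w) → ¬ Edge G x w → ⊥
  nonadjacent-impossible {x} {w} nx fw x≁w =
    separated inner∈A (not-near-nor-common⇒far outer∉A (outer∉S ∘ ∈-tabulate⁺ ∘ T-∨ˡ))
              (T-∧⁺ {adj G inner outer} edge (T-not⁺ not-deleted))
    where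
    open DeletionCover (deletion-cover x w x≁w)
    open ≤-Reasoning

    separator : Fin n → Bool
    separator y = common y ∨ cover y

    outside : ∀ {y} → ¬ T (common y) → ¬ T (cover y) → y ∉ tabulate separator
    outside {y} ¬common ¬cover y∈ = [ ¬common , ¬cover ]′ (T-∨⁻ {common y} (∈-tabulate⁻ y∈))

    small : ∣ tabulate separator ∣ < k
    small = begin-strict
      ∣ tabulate separator ∣  ≡⟨ ∣tabulate∣≡count separator ⟩
      count separator         ≤⟨ count-∨ common cover ⟩
      s + count cover         ≤⟨ +-monoʳ-≤ s (≤-trans cover-size |Fe|≤h) ⟩
      s + h                   <⟨ +-monoˡ-< h s<t ⟩
      t + h                   ≡⟨ t+h≡k ⟩
      k                       ∎

    walk : WalkAvoiding G (tabulate separator) x w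
    walk = proj₂ connected (tabulate separator) small x w
             (outside (near⇒¬common nx) x∉cover) (outside (far⇒¬common fw) w∉cover)

    open Crossing (crossing near walk nx (λ nw → near⇒¬far nw fw))

    not-deleted : ¬ T (deleted inner outer)
    not-deleted del = [ (λ ci → inner∉S (∈-tabulate⁺ (T-∨ʳ {common inner} ci)))
                      , (λ co → outer∉S (∈-tabulate⁺ (T-∨ʳ {common outer} co))) ]′ (meets edge del)

  -- Hence `far` is empty: otherwise every near–far pair is an edge of G and,
  -- by separation, a deleted one, so |near|·|far| ≤ h and
  -- n = |near| + s + |far| ≤ t + h = k, contradicting n > k.
  no-far-vertex : ∀ w₀ → ¬ T (far w₀)
  no-far-vertex w₀ fw₀ = <-irrefl refl (begin-strict
    k                           <⟨ proj₁ connected ⟩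
    n                           ≡⟨ partition ⟨
    count near + s + count far  ≤⟨ three-parts-bound (count-pos near x₀ near-x₀) (count-pos far w₀ fw₀) product≤h s<t ⟩
    t + h                       ≡⟨ t+h≡k ⟩
    k                           ∎)
    where
    open ≤-Reasoning
    all-deleted : ∀ x w → T (near x) → T (far w) → T (deleted x w)
    all-deleted x w nx fw = decidable-stable (T? (deleted x w)) λ ¬del →
      separated nx fw (T-∧⁺ {adj G x w} (decidable-stable (T? (adj G x w)) (nonadjacent-impossible nx fw)) (T-not⁺ ¬del))
    product≤h : count near * count far ≤ h
    product≤h = ≤-trans (deleted-between near far (λ _ → near⇒¬far) all-deleted) |Fe|≤h

  -- So every healthy vertex sees F₁ △ F₂; by (1) it then has no healthy
  -- neighbour in G - Fe, and by (2), (3) at most two neighbours outside S.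
  healthy-sees : ∀ {w} → T (healthy w) → T (seesDifference w)
  healthy-sees {w} hw = decidable-stable (T? (seesDifference w)) λ blind →
    no-far-vertex w (T-∧⁺ {healthy w} hw (T-not⁺ blind))

  no-healthy-neighbour : ∀ {w} → T (healthy w) → count (λ y → survives w y ∧ healthy y) ≡ 0
  no-healthy-neighbour {w} hw = count-none _ λ y wy∧hy →
    let wy , hy = T-∧⁻ {survives w y} wy∧hy
        z , dz∧wz = seen-difference (healthy-sees hw)
        dz , wz = T-∧⁻ {differ z} dz∧wz
    in no-healthy-pair hw hy dz wz wy

  few-neighbours-outside-common : ∀ {w} → T (healthy w) → count (λ y → survives w y ∧ not (common y)) ≤ 2
  few-neighbours-outside-common {w} hw = begin
    count (λ y → survives w y ∧ not (common y))
      ≤⟨ count-mono (λ y → three-ways (survives w y) (in₁ y) (in₂ y)) ⟩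
    count (λ y → to₁ y ∨ (to₂ y ∨ toHealthy y))
      ≤⟨ ≤-trans (count-∨ to₁ _) (+-monoʳ-≤ (count to₁) (count-∨ to₂ toHealthy)) ⟩
    count to₁ + (count to₂ + count toHealthy)
      ≤⟨ +-mono-≤ (one-neighbour-only₁ hw) (+-mono-≤ (one-neighbour-only₂ hw) (≤-reflexive (no-healthy-neighbour hw))) ⟩
    2 ∎
    where
    open ≤-Reasoning
    to₁ to₂ toHealthy : Fin n → Bool
    to₁ y = survives w y ∧ only₁ y
    to₂ y = survives w y ∧ only₂ y
    toHealthy y = survives w y ∧ healthy y
    three-ways : ∀ e a b → T (e ∧ not (a ∧ b)) →
                 T ((e ∧ (a ∧ not b)) ∨ ((e ∧ (b ∧ not a)) ∨ (e ∧ not (a ∨ b))))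
    three-ways true true false _ = tt
    three-ways true false true _ = tt
    three-ways true false false _ = tt

  degree-via-common : ∀ {w} → T (healthy w) →
    k ≤ count (λ y → adj G w y ∧ common y) + count (deleted w) + 2 * ⟦ healthy w ⟧
  degree-via-common {w} hw = ≤-trans (degree-split regular w common)
    (+-monoʳ-≤ _ (≤-trans (few-neighbours-outside-common hw) (≤-reflexive (cong (2 *_) (sym (⟦⟧-true hw))))))

  degree-via-faulty : ∀ {w} → T (healthy w) →
    k ≤ count (λ y → adj G w y ∧ not (healthy y)) + count (deleted w)
  degree-via-faulty {w} hw = ≤-trans (degree-split regular w (not ∘ healthy)) (≤-reflexive (begin-equality
    toFaulty + count (λ y → survives w y ∧ not (not (healthy y)))
      ≡⟨ cong (toFaulty +_) (trans (count-cong (λ y → cong (survives w y ∧_) (not-involutive (healthy y))))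
                                   (no-healthy-neighbour hw)) ⟩
    toFaulty + 0 ≡⟨ +-identityʳ toFaulty ⟩
    toFaulty ∎))
    where
    open ≤-Reasoning
    toFaulty : ℕ
    toFaulty = count (λ y → adj G w y ∧ not (healthy y)) + count (deleted w)

  m u : ℕ
  m = count healthy
  u = count (λ y → in₁ y ∨ in₂ y)

  deleted≤2h : ∑[ w < n ] count (deleted w) ≤ 2 * h
  deleted≤2h = ≤-trans deleted-total (≤-trans (+-mono-≤ |Fe|≤h |Fe|≤h) (≤-reflexive (+-double h)))

  edges-via-common : m * k ≤ s * k + 2 * h + 2 * m
  edges-via-common = begin
    m * k
      ≤⟨ count-weighted healthy k _ (λ w → degree-via-common {w}) ⟩
    ∑[ w < n ] (count (λ y → adj G w y ∧ common y) + count (deleted w) + 2 * ⟦ healthy w ⟧)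
      ≡⟨ ∑-distrib-+ (λ w → count (λ y → adj G w y ∧ common y) + count (deleted w)) (λ w → 2 * ⟦ healthy w ⟧) ⟩
    ∑[ w < n ] (count (λ y → adj G w y ∧ common y) + count (deleted w)) + ∑[ w < n ] (2 * ⟦ healthy w ⟧)
      ≡⟨ cong₂ _+_ (∑-distrib-+ (λ w → count (λ y → adj G w y ∧ common y)) (count ∘ deleted)) (sym (*-distribˡ-sum 2 (⟦_⟧ ∘ healthy))) ⟩
    ∑[ w < n ] count (λ y → adj G w y ∧ common y) + ∑[ w < n ] count (deleted w) + 2 * m
      ≤⟨ +-monoˡ-≤ (2 * m) (+-mono-≤ (≤-reflexive (RegularGraph.edges-into G regular common)) deleted≤2h) ⟩
    s * k + 2 * h + 2 * m ∎
    where open ≤-Reasoning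

  edges-via-faulty : m * k ≤ u * k + 2 * h
  edges-via-faulty = begin
    m * k
      ≤⟨ count-weighted healthy k _ (λ w → degree-via-faulty {w}) ⟩
    ∑[ w < n ] (count (λ y → adj G w y ∧ not (healthy y)) + count (deleted w))
      ≡⟨ ∑-distrib-+ (λ w → count (λ y → adj G w y ∧ not (healthy y))) (count ∘ deleted) ⟩
    ∑[ w < n ] count (λ y → adj G w y ∧ not (healthy y)) + ∑[ w < n ] count (deleted w)
      ≤⟨ +-mono-≤ (≤-reflexive (RegularGraph.edges-into G regular (not ∘ healthy))) deleted≤2h ⟩
    count (not ∘ healthy) * k + 2 * h
      ≡⟨ cong (λ c → c * k + 2 * h) (count-cong (λ y → not-involutive (in₁ y ∨ in₂ y))) ⟩
    u * k + 2 * h ∎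
    where open ≤-Reasoning

  healthy+faulty : m + u ≡ n
  healthy+faulty = trans (sym (∑-distrib-+ (⟦_⟧ ∘ healthy) (λ y → ⟦ in₁ y ∨ in₂ y ⟧)))
                         (sum-ones (λ y → complement (in₁ y ∨ in₂ y)))
    where
    complement : ∀ b → ⟦ not b ⟧ + ⟦ b ⟧ ≡ 1
    complement true = refl
    complement false = refl

  union+intersection : u + s ≤ 2 * t
  union+intersection = begin
    u + s                ≡⟨ count-∨-∧ in₁ in₂ ⟩
    count in₁ + count in₂ ≡⟨ cong₂ _+_ (∣p∣≡count F₁) (∣p∣≡count F₂) ⟨
    ∣ F₁ ∣ + ∣ F₂ ∣       ≤⟨ +-mono-≤ |F₁|≤t |F₂|≤t ⟩
    t + t                ≡⟨ +-double t ⟩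
    2 * t                ∎
    where open ≤-Reasoning

  contradiction : ⊥
  contradiction = edge-counts-impossible {m} {u} {s} {k} {h} {t} 3≤k 2h<k t+h≡k
    (≤-trans enough-vertices (≤-reflexive (sym healthy+faulty))) union+intersection
    edges-via-faulty edges-via-common

edge-tolerable-lower : ∀ {n} (G : SimpleGraph n) {k h t : ℕ} → Regular G k → Connected G k → 3 ≤ k →
                       2 * h < k → t + h ≡ k → 2 * t + 3 ≤ n → EdgeTolerableDiagnosable G h t
edge-tolerable-lower G {t = t} regular connected 3≤k 2h<k t+h≡k enough Fe |Fe|≤h =
  diagnosable-by-refutation (Deletion.edge? G Fe) t λ F₁ F₂ F₁≢F₂ |F₁|≤t |F₂|≤t ¬C₁ ¬C₂ ¬C₃ →
    IndistinguishablePair.contradiction G Fe regular connected 3≤k 2h<k t+h≡k enough |Fe|≤h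
                                        F₁ F₂ F₁≢F₂ |F₁|≤t |F₂|≤t ¬C₁ ¬C₂ ¬C₃

-- Upper bound: delete h edges at a vertex v.  Then v keeps at most k - h
-- neighbours N, and the fault sets N and N ∪ {v} cannot be told apart: they
-- differ only in v, whose neighbours all lie in N.
module UpperBound {n : ℕ} (G : SimpleGraph n) {k h : ℕ} (regular : Regular G k) (v : Fin n) where

  neighbours : List (Fin n)
  neighbours = filterᵇ (adj G v) (allFin n)

  removed : List (Fin n × Fin n)
  removed = map (v ,_) (take h neighbours)

  |removed|≤h : length removed ≤ h
  |removed|≤h = begin
    length removed                    ≡⟨ length-map (v ,_) (take h neighbours) ⟩
    length (take h neighbours)        ≡⟨ length-take h neighbours ⟩
    h ⊓ length neighbours             ≤⟨ m⊓n≤m h _ ⟩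
    h                                 ∎
    where open ≤-Reasoning

  open Deletion G removed

  remaining-degree : count (survives v) ≤ k ∸ h
  remaining-degree = begin
    count (survives v)               ≤⟨ count-mono (λ y → ∈⇒image id ∘ kept y) ⟩
    count (imageOf id (drop h neighbours))  ≤⟨ image-count id (drop h neighbours) ⟩
    length (drop h neighbours)       ≡⟨ length-drop h neighbours ⟩
    length neighbours ∸ h            ≡⟨ cong (_∸ h) (length-filter-tabulate (adj G v) id) ⟩
    count (adj G v) ∸ h              ≡⟨ cong (_∸ h) (RegularGraph.degree G regular v) ⟩
    k ∸ h                            ∎
    where
    open ≤-Reasoning
    kept : ∀ y → T (survives v y) → y ∈ₗ drop h neighbours
    kept y vy with ∈-++⁻ (take h neighbours)
                    (subst (y ∈ₗ_) (sym (take++drop≡id h neighbours))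
                           (∈-filter⁺ (T? ∘ adj G v) (∈-allFin y) (survives⇒adj vy)))
    ... | inj₂ y∈dropped = y∈dropped
    ... | inj₁ y∈taken = ⊥-elim (T-not⁻ (proj₂ (T-∧⁻ {adj G v y} vy)) (T-∨ˡ (∈⇒listed (∈-map⁺ (v ,_) y∈taken))))

  F₁ F₂ : Subset n
  F₁ = tabulate (survives v)
  F₂ = tabulate (λ y → survives v y ∨ y == v)

  F₁⊆F₂ : ∀ {y} → y ∈ F₁ → y ∈ F₂
  F₁⊆F₂ y∈ = ∈-tabulate⁺ (T-∨ˡ (∈-tabulate⁻ y∈))

  F₂−F₁ : ∀ {y} → y ∈ F₂ → y ∉ F₁ → y ≡ v
  F₂−F₁ {y} y∈F₂ y∉F₁ with T-∨⁻ {survives v y} (∈-tabulate⁻ y∈F₂)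
  ... | inj₁ vy = ⊥-elim (y∉F₁ (∈-tabulate⁺ vy))
  ... | inj₂ y≡v = ==⇒≡ y≡v

  v∉F₁ : v ∉ F₁
  v∉F₁ v∈ = no-loop G (survives⇒adj (∈-tabulate⁻ v∈))

  v∈F₂ : v ∈ F₂
  v∈F₂ = ∈-tabulate⁺ (T-∨ʳ {survives v v} (≡⇒== refl))

  |F₁|≤ : ∀ {t} → k ∸ h < t → ∣ F₁ ∣ ≤ t
  |F₁|≤ {t} k-h<t = begin
    ∣ F₁ ∣              ≡⟨ ∣tabulate∣≡count (survives v) ⟩
    count (survives v)  ≤⟨ remaining-degree ⟩
    k ∸ h               <⟨ k-h<t ⟩
    t                   ∎
    where open ≤-Reasoning

  |F₂|≤ : ∀ {t} → k ∸ h < t → ∣ F₂ ∣ ≤ t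
  |F₂|≤ {t} k-h<t = begin
    ∣ F₂ ∣                                  ≡⟨ ∣tabulate∣≡count (λ y → survives v y ∨ y == v) ⟩
    count (λ y → survives v y ∨ y == v)     ≤⟨ count-∨ (survives v) (_== v) ⟩
    count (survives v) + count (_== v)      ≤⟨ +-mono-≤ remaining-degree (count-singleton v) ⟩
    k ∸ h + 1                               ≡⟨ +-comm (k ∸ h) 1 ⟩
    suc (k ∸ h)                             ≤⟨ k-h<t ⟩
    t                                       ∎
    where open ≤-Reasoning

  -- None of the three alternatives holds for F₁ and F₂: F₁ ⊆ F₂ rules out
  -- (2) and half of (1), (3) needs two vertices of F₂ − F₁ = {v}, and a
  -- neighbour of v outside F₁ would lie in F₁.
  indistinguishable : ∀ t → k ∸ h < t → ¬ Diagnosable n (EdgeDeleted G removed) t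
  indistinguishable t k-h<t diagnosable
    with diagnosable F₁ F₂ (λ F₁≡F₂ → v∉F₁ (subst (v ∈_) (sym F₁≡F₂) v∈F₂)) (|F₁|≤ k-h<t) (|F₂|≤ k-h<t)
  ... | inj₁ (_ , _ , _ , _ , _ , inj₁ (y∈F₁ , y∉F₂) , _) = y∉F₂ (F₁⊆F₂ y∈F₁)
  ... | inj₁ (u , _ , _ , (u∉F₁ , _) , _ , inj₂ (y∈F₂ , y∉F₁) , uy , _) =
          u∉F₁ (∈-tabulate⁺ (survives-sym (subst (T ∘ survives u) (F₂−F₁ y∈F₂ y∉F₁) (edge⇒survives uy))))
  ... | inj₂ (inj₁ (_ , _ , _ , _ , (y∈F₁ , y∉F₂) , _)) = y∉F₂ (F₁⊆F₂ y∈F₁)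
  ... | inj₂ (inj₂ (_ , _ , _ , u≢y , (u∈F₂ , u∉F₁) , (y∈F₂ , y∉F₁) , _)) =
          u≢y (trans (F₂−F₁ u∈F₂ u∉F₁) (sym (F₂−F₁ y∈F₂ y∉F₁)))

corollary4p6 : (n : ℕ) (G : SimpleGraph n) (k : ℕ) →
    Regular G k → Connected G k → 3 ≤ k →
    (h : ℕ) → h ≤ ⌊ k ∸ 1 /2⌋ → 2 * (k ∸ h) + 3 ≤ n →
    EdgeTolerableDiagnosability≡ G h (k ∸ h)
corollary4p6 n G k regular connected 3≤k h h≤⌊k-1/2⌋ enough = lower , upper
  where
  2h<k′ : 2 * h < k
  2h<k′ = 2h<k (≤-trans (s≤s z≤n) 3≤k) h≤⌊k-1/2⌋

  t+h≡k : k ∸ h + h ≡ k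
  t+h≡k = m∸n+n≡m (≤-trans (m≤n+m h h) (≤-trans (≤-reflexive (+-double h)) (<⇒≤ 2h<k′)))

  lower : EdgeTolerableDiagnosable G h (k ∸ h)
  lower = edge-tolerable-lower G regular connected 3≤k 2h<k′ t+h≡k enough

  -- any vertex serves for the upper bound; there is one since n > k
  v : Fin n
  v = fromℕ< (≤-trans (s≤s z≤n) (proj₁ connected))

  upper : ∀ t → EdgeTolerableDiagnosable G h t → t ≤ k ∸ h
  upper t tolerable = decidable-stable (t ≤? k ∸ h) λ t≰k-h →
    indistinguishable t (≰⇒> t≰k-h) (tolerable removed |removed|≤h)
    where open UpperBound G {k} {h} regular v
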